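{- Let $\lambda\in\mathbb{C}_p$ with $\lambda\ne0$ and $|\lambda|_p\le1$ ($p$ an odd prime), let $r\in\mathbb{N}$ and let $k$ be an integer with $0\le k\le r$. For every $n\ge0$, \[ Ch^{(r)}_{n,\lambda}(x)=\sum_{l=0}^n\binom{n}{l}Ch^{(k)}_{l,\lambda}\,Ch^{(r-k)}_{n-l,\lambda}(x). \]
   Context: Write $(x)_{0,\lambda}=1$, $(x)_{n,\lambda}=x(x-\lambda)\cdots(x-(n-1)\lambda)$, and $(1+\lambda u)^{x/\lambda}=\sum_{m\ge0}(x)_{m,\lambda}u^m/m!$. For an integer $s\ge0$, the higher-order degenerate Changhee polynomials of the second kind are defined by $\left(\frac{2}{1+(1+\lambda\log(1+t))^{1/\lambda}}\right)^s(1+\lambda\log(1+t))^{x/\lambda}=\sum_{n\ge0}Ch^{(s)}_{n,\lambda}(x)\frac{t^n}{n!}$, and $Ch^{(s)}_{n,\lambda}=Ch^{(s)}_{n,\lambda}(0)$. -}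

module Defs where

open import Algebra.Bundles using (CommutativeRing)
open import Data.Bool using (if_then_else_)
open import Data.Nat as ℕ using (ℕ; zero; suc; _∸_; _!; _≤ᵇ_)
open import Data.Nat.Combinatorics using (_C_)

-- Exponential generating series over a commutative ring R.
-- A series f : ℕ → Carrier stands for  Σ_n f n · t^n / n!.
module EGF {c ℓ} (R : CommutativeRing c ℓ) where
  open CommutativeRing R

  Series : Set c
  Series = ℕ → Carrier

  fromℕ : ℕ → Carrier
  fromℕ zero    = 0#
  fromℕ (suc n) = 1# + fromℕ n

  sumTo : ℕ → (ℕ → Carrier) → Carrier
  sumTo zero    f = f 0
  sumTo (suc n) f = sumTo n f + f (suc n)

  _⊛_ : Series → Series → Series
  (f ⊛ g) n = sumTo n (λ l → fromℕ (n C l) * f l * g (n ∸ l))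

  one : Series
  one zero    = 1#
  one (suc _) = 0#

  _^ₛ_ : Series → ℕ → Series
  f ^ₛ zero  = one
  f ^ₛ suc s = f ⊛ (f ^ₛ s)

  fallingλ : Carrier → Carrier → ℕ → Carrier
  fallingλ lam x zero    = 1#
  fallingλ lam x (suc m) = fallingλ lam x m * (x - fromℕ m * lam)

  sgn : ℕ → Carrier
  sgn zero    = 1#
  sgn (suc n) = - sgn n

  -- log(1+t) = Σ_{n≥1} (-1)^{n-1} t^n / n = Σ_{n≥1} (-1)^{n-1} (n-1)! t^n / n!
  logSeries : Series
  logSeries zero    = 0#
  logSeries (suc n) = sgn n * fromℕ (n !)

  -- divided powers  g^[m] = g^m / m!  of a series g with g 0 = 0,
  -- characterised by g^[0] = 1, g^[m+1](0) = 0, (g^[m+1])' = g' · g^[m]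
  -- (the derivative of an EGF is the shift of its coefficients).
  dpow : Series → ℕ → Series
  dpow g zero    = one
  dpow g (suc m) zero    = 0#
  dpow g (suc m) (suc n) =
    sumTo n (λ l → fromℕ (n C l) * g (suc l) * dpow g m (n ∸ l))

  -- (1 + λ log(1+t))^{x/λ} = Σ_m (x)_{m,λ} (log(1+t))^m / m!
  -- (the m-th summand contributes only to coefficients of index ≥ m).
  degExpLog : Carrier → Carrier → Series
  degExpLog lam x n = sumTo n (λ m → fallingλ lam x m * dpow logSeries m n)

  denom : Carrier → Series
  denom lam n = one n + degExpLog lam 1# n

  -- Given half = 1/2, the series 2 / (1 + (1+λ log(1+t))^{1/λ}), i.e. the
  -- unique G with denom ⊛ G = 2 (denom has constant term 2).
  -- approx n agrees with G on the coefficients 0..n.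
  approx : Carrier → Carrier → ℕ → Series
  approx half lam zero    _ = half * (1# + 1#)
  approx half lam (suc n) i =
    if i ≤ᵇ n then approx half lam n i
    else (half * (- sumTo n (λ j → fromℕ (suc n C suc j)
                                    * denom lam (suc j)
                                    * approx half lam n (n ∸ j))))

  twoOver : Carrier → Carrier → Series
  twoOver half lam n = approx half lam n n

  -- higher-order degenerate Changhee polynomials of the second kind:
  -- (2/(1+(1+λlog(1+t))^{1/λ}))^s (1+λ log(1+t))^{x/λ} = Σ_n Ch^{(s)}_{n,λ}(x) t^n/n!
  Ch : Carrier → Carrier → ℕ → ℕ → Carrier → Carrier
  Ch half lam s n x = ((twoOver half lam ^ₛ s) ⊛ degExpLog lam x) n

module Submission where

-- Write G = 2/(1 + (1+λlog(1+t))^{1/λ}) and E_x = (1+λlog(1+t))^{x/λ},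
-- so that Ch^{(s)}(x) is the coefficient sequence of G^s · E_x.  The identity is
--   G^r E_x = G^k · G^{r-k} E_x   with   G^k = G^k E_0,
-- i.e. it only uses (a) the algebra of exponential generating series under the
-- binomial (Cauchy) product ⊛ — associativity, unit laws, and G^{a+b} = G^a G^b —
-- and (b) the fact E_0 = 1, which holds because (0)_{m,λ} = 0 for m ≥ 1.
-- Neither the value of 1/2 nor λ ≠ 0 is needed, and G may be any series.

open import Defs
open import Algebra.Bundles using (CommutativeRing)
open import Data.Nat as ℕ using (ℕ; zero; suc; _≤_; _∸_; z≤n)
open import Data.Nat.Combinatorics using (_C_; k>n⇒nCk≡0; nCk+nC[k+1]≡[n+1]C[k+1])
import Data.Nat.Properties as ℕₚ
open import Relation.Nullary using (¬_)
open import Relation.Binary.PropositionalEquality as ≡ using (_≡_)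
import Algebra.Properties.CommutativeSemigroup as CommSemigroupProperties
import Relation.Binary.Reasoning.Setoid as SetoidReasoning

module SeriesAlgebra {c ℓ} (R : CommutativeRing c ℓ) where
  open CommutativeRing R
  open EGF R
  open SetoidReasoning setoid
  open CommSemigroupProperties +-commutativeSemigroup using (interchange)

  sumTo-cong : ∀ n {f g : ℕ → Carrier} → (∀ i → i ≤ n → f i ≈ g i) →
               sumTo n f ≈ sumTo n g
  sumTo-cong zero    e = e 0 z≤n
  sumTo-cong (suc n) e =
    +-cong (sumTo-cong n (λ i i≤n → e i (ℕₚ.m≤n⇒m≤1+n i≤n))) (e (suc n) ℕₚ.≤-refl)

  sumTo-+ : ∀ n (f g : ℕ → Carrier) →
            sumTo n (λ i → f i + g i) ≈ sumTo n f + sumTo n g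
  sumTo-+ zero    f g = refl
  sumTo-+ (suc n) f g =
    trans (+-congʳ (sumTo-+ n f g)) (interchange _ _ _ _)

  sumTo-front : ∀ n (f : ℕ → Carrier) →
                sumTo (suc n) f ≈ f 0 + sumTo n (λ i → f (suc i))
  sumTo-front zero    f = refl
  sumTo-front (suc n) f =
    trans (+-congʳ (sumTo-front n f)) (+-assoc _ _ _)

  sumTo-zeros : ∀ n → sumTo n (λ _ → 0#) ≈ 0#
  sumTo-zeros zero    = refl
  sumTo-zeros (suc n) = trans (+-identityʳ _) (sumTo-zeros n)

  fromℕ-+ : ∀ a b → fromℕ (a ℕ.+ b) ≈ fromℕ a + fromℕ b
  fromℕ-+ zero    b = sym (+-identityˡ _)
  fromℕ-+ (suc a) b = trans (+-congˡ (fromℕ-+ a b)) (sym (+-assoc _ _ _))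

  fromℕ-1 : fromℕ 1 ≈ 1#
  fromℕ-1 = +-identityʳ 1#

  infix 4 _≋_
  _≋_ : Series → Series → Set ℓ
  f ≋ g = ∀ n → f n ≈ g n

  _⊕_ : Series → Series → Series
  (f ⊕ g) n = f n + g n

  zeroₛ : Series
  zeroₛ _ = 0#

  D : Series → Series
  D f n = f (suc n)

  ⊛-cong : ∀ {f f′ g g′} → f ≋ f′ → g ≋ g′ → f ⊛ g ≋ f′ ⊛ g′
  ⊛-cong ef eg n = sumTo-cong n (λ l _ → *-cong (*-congˡ (ef l)) (eg (n ∸ l)))

  ⊛-distribʳ : ∀ f g h → (f ⊕ g) ⊛ h ≋ (f ⊛ h) ⊕ (g ⊛ h)
  ⊛-distribʳ f g h n =
    trans (sumTo-cong n (λ l _ → trans (*-congʳ (distribˡ _ _ _)) (distribʳ _ _ _)))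
          (sumTo-+ n _ _)

  ⊛-distribˡ : ∀ f g h → f ⊛ (g ⊕ h) ≋ (f ⊛ g) ⊕ (f ⊛ h)
  ⊛-distribˡ f g h n =
    trans (sumTo-cong n (λ _ _ → distribˡ _ _ _)) (sumTo-+ n _ _)

  ⊛-zeroʳ : ∀ f → f ⊛ zeroₛ ≋ zeroₛ
  ⊛-zeroʳ f n = trans (sumTo-cong n (λ _ _ → zeroʳ _)) (sumTo-zeros n)

  ⊛-zeroˡ : ∀ g → zeroₛ ⊛ g ≋ zeroₛ
  ⊛-zeroˡ g n =
    trans (sumTo-cong n (λ _ _ → trans (*-congʳ (zeroʳ _)) (zeroˡ _))) (sumTo-zeros n)

  ⊛-at-0 : ∀ f g → (f ⊛ g) 0 ≈ f 0 * g 0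
  ⊛-at-0 f g = *-congʳ (trans (*-congʳ fromℕ-1) (*-identityˡ _))

  pascal : ∀ n l a b → fromℕ (suc n C suc l) * a * b
                       ≈ fromℕ (n C l) * a * b + fromℕ (n C suc l) * a * b
  pascal n l a b = begin
    fromℕ (suc n C suc l) * a * b
      ≈⟨ reflexive (≡.cong (λ m → fromℕ m * a * b)
                           (≡.sym (nCk+nC[k+1]≡[n+1]C[k+1] n l))) ⟩
    fromℕ (n C l ℕ.+ n C suc l) * a * b
      ≈⟨ *-congʳ (*-congʳ (fromℕ-+ (n C l) (n C suc l))) ⟩
    (fromℕ (n C l) + fromℕ (n C suc l)) * a * b
      ≈⟨ trans (*-congʳ (distribʳ _ _ _)) (distribʳ _ _ _) ⟩
    fromℕ (n C l) * a * b + fromℕ (n C suc l) * a * b ∎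

  -- (f ⊛ Dg)_n written with the binomial coefficients C(n,l) over l ≤ n+1;
  -- the extra term l = n+1 vanishes since C(n,n+1) = 0.
  ⊛-shiftʳ : ∀ f g n →
    (f ⊛ D g) n ≈ sumTo (suc n) (λ l → fromℕ (n C l) * f l * g (suc n ∸ l))
  ⊛-shiftʳ f g n = sym (begin
    sumTo n t + t (suc n)
      ≈⟨ +-congˡ last-vanishes ⟩
    sumTo n t + 0#
      ≈⟨ +-identityʳ _ ⟩
    sumTo n t
      ≈⟨ sumTo-cong n (λ l l≤n →
           reflexive (≡.cong (λ m → fromℕ (n C l) * f l * g m) (ℕₚ.+-∸-assoc 1 l≤n))) ⟩
    (f ⊛ D g) n ∎)
    where
    t : ℕ → Carrier
    t l = fromℕ (n C l) * f l * g (suc n ∸ l)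
    last-vanishes : t (suc n) ≈ 0#
    last-vanishes = begin
      fromℕ (n C suc n) * f (suc n) * g (n ∸ n)
        ≈⟨ reflexive (≡.cong (λ m → fromℕ m * f (suc n) * g (n ∸ n))
                             (k>n⇒nCk≡0 (ℕₚ.n<1+n n))) ⟩
      0# * f (suc n) * g (n ∸ n) ≈⟨ trans (*-congʳ (zeroˡ _)) (zeroˡ _) ⟩
      0# ∎

  leibniz : ∀ f g n → (f ⊛ g) (suc n) ≈ (D f ⊛ g) n + (f ⊛ D g) n
  leibniz f g n = begin
    (f ⊛ g) (suc n)
      ≈⟨ sumTo-front n _ ⟩
    t 0 + sumTo n (λ l → fromℕ (suc n C suc l) * f (suc l) * g (n ∸ l))
      ≈⟨ +-congˡ (sumTo-cong n (λ l _ → pascal n l (f (suc l)) (g (n ∸ l)))) ⟩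
    t 0 + sumTo n (λ l → fromℕ (n C l) * f (suc l) * g (n ∸ l) + t (suc l))
      ≈⟨ +-congˡ (sumTo-+ n _ _) ⟩
    t 0 + ((D f ⊛ g) n + sumTo n (λ l → t (suc l)))
      ≈⟨ trans (sym (+-assoc _ _ _)) (trans (+-congʳ (+-comm _ _)) (+-assoc _ _ _)) ⟩
    (D f ⊛ g) n + (t 0 + sumTo n (λ l → t (suc l)))
      ≈⟨ +-congˡ (trans (sym (sumTo-front n t)) (sym (⊛-shiftʳ f g n))) ⟩
    (D f ⊛ g) n + (f ⊛ D g) n ∎
    where
    t : ℕ → Carrier
    t l = fromℕ (n C l) * f l * g (suc n ∸ l)

  -- Associativity, by induction on the index: both sides agree at 0 and
  -- their shifts agree by the Leibniz rule.
  ⊛-assoc : ∀ f g h → (f ⊛ g) ⊛ h ≋ f ⊛ (g ⊛ h)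
  ⊛-assoc f g h zero = begin
    ((f ⊛ g) ⊛ h) 0   ≈⟨ trans (⊛-at-0 (f ⊛ g) h) (*-congʳ (⊛-at-0 f g)) ⟩
    f 0 * g 0 * h 0   ≈⟨ *-assoc _ _ _ ⟩
    f 0 * (g 0 * h 0) ≈⟨ sym (trans (⊛-at-0 f (g ⊛ h)) (*-congˡ (⊛-at-0 g h))) ⟩
    (f ⊛ (g ⊛ h)) 0 ∎
  ⊛-assoc f g h (suc n) = begin
    ((f ⊛ g) ⊛ h) (suc n)
      ≈⟨ leibniz (f ⊛ g) h n ⟩
    (D (f ⊛ g) ⊛ h) n + ((f ⊛ g) ⊛ D h) n
      ≈⟨ +-congʳ (trans (⊛-cong {g = h} (leibniz f g) (λ _ → refl) n) (⊛-distribʳ _ _ h n)) ⟩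
    (((D f ⊛ g) ⊛ h) n + ((f ⊛ D g) ⊛ h) n) + ((f ⊛ g) ⊛ D h) n
      ≈⟨ +-cong (+-cong (⊛-assoc (D f) g h n) (⊛-assoc f (D g) h n))
                (⊛-assoc f g (D h) n) ⟩
    ((D f ⊛ (g ⊛ h)) n + (f ⊛ (D g ⊛ h)) n) + (f ⊛ (g ⊛ D h)) n
      ≈⟨ +-assoc _ _ _ ⟩
    (D f ⊛ (g ⊛ h)) n + ((f ⊛ (D g ⊛ h)) n + (f ⊛ (g ⊛ D h)) n)
      ≈⟨ +-congˡ (sym (trans (⊛-cong {f = f} (λ _ → refl) (leibniz g h) n)
                             (⊛-distribˡ f (D g ⊛ h) (g ⊛ D h) n))) ⟩
    (D f ⊛ (g ⊛ h)) n + (f ⊛ D (g ⊛ h)) n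
      ≈⟨ sym (leibniz f (g ⊛ h) n) ⟩
    (f ⊛ (g ⊛ h)) (suc n) ∎

  -- Unit laws, again by the Leibniz rule, using D one = 0.
  ⊛-identityˡ : ∀ f → one ⊛ f ≋ f
  ⊛-identityˡ f zero    = trans (⊛-at-0 one f) (*-identityˡ _)
  ⊛-identityˡ f (suc n) = begin
    (one ⊛ f) (suc n)               ≈⟨ leibniz one f n ⟩
    (zeroₛ ⊛ f) n + (one ⊛ D f) n   ≈⟨ +-cong (⊛-zeroˡ f n) (⊛-identityˡ (D f) n) ⟩
    0# + f (suc n)                  ≈⟨ +-identityˡ _ ⟩
    f (suc n) ∎

  ⊛-identityʳ : ∀ f → f ⊛ one ≋ f
  ⊛-identityʳ f zero    = trans (⊛-at-0 f one) (*-identityʳ _)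
  ⊛-identityʳ f (suc n) = begin
    (f ⊛ one) (suc n)               ≈⟨ leibniz f one n ⟩
    (D f ⊛ one) n + (f ⊛ zeroₛ) n   ≈⟨ +-cong (⊛-identityʳ (D f) n) (⊛-zeroʳ f n) ⟩
    f (suc n) + 0#                  ≈⟨ +-identityʳ _ ⟩
    f (suc n) ∎

  ^ₛ-+ : ∀ G a b → G ^ₛ (a ℕ.+ b) ≋ (G ^ₛ a) ⊛ (G ^ₛ b)
  ^ₛ-+ G zero    b n = sym (⊛-identityˡ (G ^ₛ b) n)
  ^ₛ-+ G (suc a) b n =
    trans (⊛-cong {f = G} (λ _ → refl) (^ₛ-+ G a b) n)
          (sym (⊛-assoc G (G ^ₛ a) (G ^ₛ b) n))

  -- (0)_{m,λ} = 0 for m ≥ 1, since its first factor is 0 − 0·λ.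
  fallingλ-at-0 : ∀ lam m → fallingλ lam 0# (suc m) ≈ 0#
  fallingλ-at-0 lam zero = begin
    1# * (0# - 0# * lam) ≈⟨ *-identityˡ _ ⟩
    0# - 0# * lam        ≈⟨ +-congˡ (-‿cong (zeroˡ _)) ⟩
    0# - 0#              ≈⟨ -‿inverseʳ _ ⟩
    0# ∎
  fallingλ-at-0 lam (suc m) = trans (*-congʳ (fallingλ-at-0 lam m)) (zeroˡ _)

  -- (1 + λlog(1+t))^{0/λ} = 1: only the m = 0 summand survives.
  degExpLog-at-0 : ∀ lam → degExpLog lam 0# ≋ one
  degExpLog-at-0 lam n = begin
    sumTo n (λ m → fallingλ lam 0# m * dpow logSeries m n)
      ≈⟨ only-first-term n ⟩
    1# * one n ≈⟨ *-identityˡ _ ⟩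
    one n ∎
    where
    only-first-term : ∀ k → sumTo k (λ m → fallingλ lam 0# m * dpow logSeries m n)
                         ≈ 1# * one n
    only-first-term zero    = refl
    only-first-term (suc k) =
      trans (+-cong (only-first-term k) (trans (*-congʳ (fallingλ-at-0 lam k)) (zeroˡ _)))
            (+-identityʳ _)

  Ch-at-0 : ∀ half lam s → (λ n → Ch half lam s n 0#) ≋ twoOver half lam ^ₛ s
  Ch-at-0 half lam s n =
    trans (⊛-cong (λ _ → refl) (degExpLog-at-0 lam) n) (⊛-identityʳ _ n)

theorem2p13 : ∀ {c ℓ} (R : CommutativeRing c ℓ) →
  let open CommutativeRing R
      open EGF R
  in (half : Carrier) → half * (1# + 1#) ≈ 1# →
     (lam : Carrier) → ¬ (lam ≈ 0#) →
     (r k : ℕ) → k ≤ r → (x : Carrier) → (n : ℕ) →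
     Ch half lam r n x
       ≈ sumTo n (λ l → fromℕ (n C l) * Ch half lam k l 0#
                            * Ch half lam (r ∸ k) (n ∸ l) x)
theorem2p13 R half _ lam _ r k k≤r x n = begin
  ((G ^ₛ r) ⊛ E) n
    ≈⟨ reflexive (≡.cong (λ s → ((G ^ₛ s) ⊛ E) n) (≡.sym (ℕₚ.m+[n∸m]≡n k≤r))) ⟩
  ((G ^ₛ (k ℕ.+ (r ∸ k))) ⊛ E) n
    ≈⟨ ⊛-cong {g = E} (^ₛ-+ G k (r ∸ k)) (λ _ → refl) n ⟩
  (((G ^ₛ k) ⊛ (G ^ₛ (r ∸ k))) ⊛ E) n
    ≈⟨ ⊛-assoc (G ^ₛ k) (G ^ₛ (r ∸ k)) E n ⟩
  ((G ^ₛ k) ⊛ ((G ^ₛ (r ∸ k)) ⊛ E)) n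
    ≈⟨ ⊛-cong {g = (G ^ₛ (r ∸ k)) ⊛ E} (λ l → sym (Ch-at-0 half lam k l)) (λ _ → refl) n ⟩
  sumTo n (λ l → fromℕ (n C l) * Ch half lam k l 0# * Ch half lam (r ∸ k) (n ∸ l) x) ∎
  where
  open CommutativeRing R
  open EGF R
  open SeriesAlgebra R
  open SetoidReasoning setoid
  G = twoOver half lam
  E = degExpLog lam x
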